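{- Let $a,b,n$ be positive integers with $a$ odd. Then $$t(a,3a,b;n)=\begin{cases}2N(4a,12a,b;8n+4a+b)&\text{if }b\text{ is odd},\\2N(2a,6a,b/2;4n+2a+b/2)&\text{if }4\mid b-2,\\2N(a,3a,b/4;2n+a+b/4)-2N(a,3a,b;2n+a+b/4)&\text{if }4\mid b.\end{cases}$$
   Context: For positive integers $a_1,\dots,a_k$ and a nonnegative integer $n$, $N(a_1,\dots,a_k;n)$ is the number of $(x_1,\dots,x_k)\in\mathbb Z^k$ with $n=a_1x_1^2+\cdots+a_kx_k^2$, and $t(a_1,\dots,a_k;n)$ is the number of $(x_1,\dots,x_k)\in\mathbb Z^k$ with $n=a_1\frac{x_1(x_1-1)}2+\cdots+a_k\frac{x_k(x_k-1)}2$. -}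

module Defs where

open import Data.Nat as ℕ using (ℕ; zero; suc)
open import Data.Integer as ℤ using (ℤ; +_)
open import Data.List using (List; map; upTo)
open import Data.Nat.ListAction using (sum)
open import Relation.Nullary.Decidable using (⌊_⌋)
open import Data.Bool using (if_then_else_)

range : ℕ → ℕ → List ℤ
range lo hi = map (λ i → (+ i) ℤ.- (+ lo)) (upTo (suc (lo ℕ.+ hi)))

count3 : List ℤ → (ℤ → ℤ → ℤ → ℤ) → ℤ → ℕ
count3 L f v =
  sum (map (λ x → sum (map (λ y → sum (map (λ z →
    if ⌊ f x y z ℤ.≟ v ⌋ then 1 else 0) L)) L)) L)

-- N(a1,a2,a3;n) = #{(x1,x2,x3) ∈ ℤ³ : n = a1 x1² + a2 x2² + a3 x3²}.
-- For positive coefficients every solution has |xi| ≤ n, so counting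
-- over [-n, n]³ counts all integer solutions.
N3 : ℕ → ℕ → ℕ → ℕ → ℕ
N3 a1 a2 a3 n =
  count3 (range n n)
    (λ x y z → (+ a1) ℤ.* (x ℤ.* x) ℤ.+ (+ a2) ℤ.* (y ℤ.* y) ℤ.+ (+ a3) ℤ.* (z ℤ.* z))
    (+ n)

-- t(a1,a2,a3;n) = #{(x1,x2,x3) ∈ ℤ³ : n = Σ ai xi(xi-1)/2}, written with the
-- equation multiplied by 2 (xi(xi-1) is always even).  For positive
-- coefficients every solution has -n ≤ xi ≤ n+1, so counting over
-- [-n, n+1]³ counts all integer solutions.
t3 : ℕ → ℕ → ℕ → ℕ → ℕ
t3 a1 a2 a3 n =
  count3 (range n (suc n))
    (λ x y z → (+ a1) ℤ.* (x ℤ.* (x ℤ.- + 1)) ℤ.+ (+ a2) ℤ.* (y ℤ.* (y ℤ.- + 1))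
               ℤ.+ (+ a3) ℤ.* (z ℤ.* (z ℤ.- + 1)))
    (+ (2 ℕ.* n))

{-# OPTIONS --safe #-}
-- Completing squares, x ↦ 2x − 1 identifies t(a,3a,b;n) with the number of representations of
-- 8n + 4a + b by aX² + 3aY² + bZ² with X, Y, Z odd.  For odd X, Y exactly one of Y − X, Y + X is
-- divisible by 4, and accordingly (X, Y) = (u − 3v, u + v) or (−u − 3v, u − v), where
-- X² + 3Y² = 4(u² + 3v²).  This is a two-to-one correspondence with the solutions of
-- 4au² + 12av² + bw² = 8n + 4a + b with w odd (u + v is then odd because a is odd).  If b is odd,
-- w is odd on every solution; if b = 2c with c odd, halve the equation and w is again forced odd;
-- if b = 4d, divide by 4 and discard the solutions with w = 2k even, which are exactly the
-- solutions of au² + 3av² + 4dk² = 2n + a + d.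
module Submission where

open import Defs

open import Data.Bool using (Bool; true; false; if_then_else_)
open import Data.List using (List; []; _∷_; _++_; map; cartesianProduct)
open import Data.List.Membership.Propositional using (_∈_)
open import Data.List.Membership.Propositional.Properties using (∈-cartesianProduct⁺)
open import Data.List.Relation.Unary.Any using (here; there; _─_)
open import Data.List.Relation.Unary.AllPairs using ([]; _∷_)
open import Data.List.Relation.Unary.All as All using ([]; _∷_)
open import Data.List.Relation.Unary.Unique.Propositional using (Unique)
open import Data.List.Relation.Unary.Unique.Propositional.Properties using (cartesianProduct⁺)
open import Data.Nat.ListAction using (sum)
open import Data.Product using (_×_; _,_; proj₁; proj₂; ∃-syntax)
open import Function using (_∘_; id; _⇔_; mk⇔; Equivalence)
open import Level using (0ℓ)
open import Relation.Binary.PropositionalEquality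
open import Relation.Nullary using (yes; no; ¬_; contradiction)
open import Relation.Nullary.Decidable using (⌊_⌋)
open import Relation.Unary using (Pred; Decidable; _∩_; ∁; _≐_)
open import Relation.Unary.Properties using (_∩?_; ∁?)

module Counting where

  open import Data.Nat using (ℕ; suc; _+_; _*_; _≤_; z≤n; s≤s)
  open import Data.Nat.Properties using (+-suc; *-suc; ≤-antisym; ≤-reflexive; ≤-trans)

  count : {A : Set} {P : Pred A 0ℓ} → Decidable P → List A → ℕ
  count P? []       = 0
  count P? (x ∷ xs) with P? x
  ... | yes _ = suc (count P? xs)
  ... | no  _ = count P? xs

  module _ {A : Set} {P : Pred A 0ℓ} (P? : Decidable P) where

    sum-indicator : ∀ xs → sum (map (λ x → if ⌊ P? x ⌋ then 1 else 0) xs) ≡ count P? xs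
    sum-indicator []       = refl
    sum-indicator (x ∷ xs) with P? x
    ... | yes _ = cong suc (sum-indicator xs)
    ... | no  _ = sum-indicator xs

    count-++ : ∀ xs ys → count P? (xs ++ ys) ≡ count P? xs + count P? ys
    count-++ []       ys = refl
    count-++ (x ∷ xs) ys with P? x
    ... | yes _ = cong suc (count-++ xs ys)
    ... | no  _ = count-++ xs ys

    count-map : {B : Set} (f : B → A) (xs : List B) → count P? (map f xs) ≡ count (P? ∘ f) xs
    count-map f []       = refl
    count-map f (x ∷ xs) with P? (f x)
    ... | yes _ = cong suc (count-map f xs)
    ... | no  _ = count-map f xs

    count-accept : ∀ {x} xs → P x → count P? (x ∷ xs) ≡ suc (count P? xs)
    count-accept {x} xs px with P? x
    ... | yes _  = refl
    ... | no ¬px = contradiction px ¬px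

    count-reject : ∀ {x} xs → ¬ P x → count P? (x ∷ xs) ≡ count P? xs
    count-reject {x} xs ¬px with P? x
    ... | yes px = contradiction px ¬px
    ... | no  _  = refl

    count-─ : ∀ {x xs} (i : x ∈ xs) → P x → count P? xs ≡ suc (count P? (xs ─ i))
    count-─ (here refl) px = count-accept _ px
    count-─ {xs = y ∷ xs} (there i) px with P? y
    ... | yes _ = cong suc (count-─ i px)
    ... | no  _ = count-─ i px

    module _ {Q : Pred A 0ℓ} (Q? : Decidable Q) where

      count-split : ∀ xs → count P? xs ≡ count (P? ∩? Q?) xs + count (P? ∩? ∁? Q?) xs
      count-split []       = refl
      count-split (x ∷ xs) with P? x | Q? x
      ... | no  _ | _     = count-split xs
      ... | yes _ | yes _ = cong suc (count-split xs)
      ... | yes _ | no  _ = trans (cong suc (count-split xs)) (sym (+-suc _ _))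

  count-cartesianProduct : {A B : Set} {P : Pred (A × B) 0ℓ} (P? : Decidable P) (xs : List A) (ys : List B) →
    count P? (cartesianProduct xs ys) ≡ sum (map (λ x → count (P? ∘ (x ,_)) ys) xs)
  count-cartesianProduct P? []       ys = refl
  count-cartesianProduct P? (x ∷ xs) ys = begin
    count P? (map (x ,_) ys ++ cartesianProduct xs ys)
      ≡⟨ count-++ P? (map (x ,_) ys) _ ⟩
    count P? (map (x ,_) ys) + count P? (cartesianProduct xs ys)
      ≡⟨ cong₂ _+_ (count-map P? (x ,_) ys) (count-cartesianProduct P? xs ys) ⟩
    count (P? ∘ (x ,_)) ys + sum (map (λ x → count (P? ∘ (x ,_)) ys) xs) ∎
    where open ≡-Reasoning

  ∈-─ : {A : Set} {y z : A} {ys : List A} (i : y ∈ ys) → z ∈ ys → z ≢ y → z ∈ (ys ─ i)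
  ∈-─ (here refl) (here refl) z≢y = contradiction refl z≢y
  ∈-─ (here refl) (there j)   _   = j
  ∈-─ (there i)   (here refl) _   = here refl
  ∈-─ (there i)   (there j)   z≢y = there (∈-─ i j z≢y)

  module _ {A B : Set} {P : Pred A 0ℓ} {Q : Pred B 0ℓ} (P? : Decidable P) (Q? : Decidable Q) where

    count-≤-injection : (R : A → B → Set) → (∀ {x x′ y} → P x → P x′ → R x y → R x′ y → x ≡ x′) →
      ∀ {xs ys} → Unique xs → (∀ {x} → x ∈ xs → P x → ∃[ y ] y ∈ ys × Q y × R x y) →
      count P? xs ≤ count Q? ys
    count-≤-injection R inj {[]}     _            _       = z≤n
    count-≤-injection R inj {x ∷ xs} (x≢xs ∷ xs!) partner with P? x
    ... | no  _  = count-≤-injection R inj xs! (partner ∘ there)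
    ... | yes px with partner (here refl) px
    ...   | y , y∈ys , qy , rxy =
      ≤-trans (s≤s (count-≤-injection R inj xs! partner′)) (≤-reflexive (sym (count-─ Q? y∈ys qy)))
      where
      partner′ : ∀ {x′} → x′ ∈ xs → P x′ → ∃[ y′ ] y′ ∈ (_ ─ y∈ys) × Q y′ × R x′ y′
      partner′ x′∈xs px′ with partner (there x′∈xs) px′
      ... | y′ , y′∈ys , qy′ , rx′y′ = y′ , ∈-─ y∈ys y′∈ys y′≢y , qy′ , rx′y′
        where
        y′≢y : y′ ≢ y
        y′≢y refl = All.lookup x≢xs x′∈xs (sym (inj px′ px rx′y′ rxy))

  count-bijection : {A B : Set} {P : Pred A 0ℓ} {Q : Pred B 0ℓ} (P? : Decidable P) (Q? : Decidable Q) →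
    ∀ {xs ys} → Unique xs → Unique ys → (f : A → B) →
    (∀ {x} → x ∈ xs → P x → f x ∈ ys × Q (f x)) →
    (∀ {x x′} → P x → P x′ → f x ≡ f x′ → x ≡ x′) →
    (∀ {y} → y ∈ ys → Q y → ∃[ x ] x ∈ xs × P x × f x ≡ y) →
    count P? xs ≡ count Q? ys
  count-bijection P? Q? xs! ys! f into injective onto = ≤-antisym
    (count-≤-injection P? Q? (λ x y → f x ≡ y) (λ px px′ e e′ → injective px px′ (trans e (sym e′))) xs!
      (λ x∈xs px → f _ , proj₁ (into x∈xs px) , proj₂ (into x∈xs px) , refl))
    (count-≤-injection Q? P? (λ y x → f x ≡ y) (λ _ _ e e′ → trans (sym e) e′) ys! onto)

  count-≐ : {A : Set} {P Q : Pred A 0ℓ} (P? : Decidable P) (Q? : Decidable Q) {xs ys : List A} →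
    Unique xs → Unique ys → (∀ {x} → P x → x ∈ ys) → (∀ {x} → Q x → x ∈ xs) → P ≐ Q →
    count P? xs ≡ count Q? ys
  count-≐ P? Q? xs! ys! P⊆ys Q⊆xs (P⊆Q , Q⊆P) =
    count-bijection P? Q? xs! ys! id (λ _ px → P⊆ys px , P⊆Q px) (λ _ _ → id) (λ _ qx → _ , Q⊆xs qx , Q⊆P qx , refl)

  count-×-Bool : {A : Set} {P : Pred A 0ℓ} (P? : Decidable P) (xs : List A) →
    count (P? ∘ proj₁) (cartesianProduct xs (true ∷ false ∷ [])) ≡ 2 * count P? xs
  count-×-Bool P? []       = refl
  count-×-Bool P? (x ∷ xs) with P? x
  ... | yes px = trans (cong suc (count-accept (P? ∘ proj₁) (cartesianProduct xs _) px))
                       (trans (cong (suc ∘ suc) (count-×-Bool P? xs)) (sym (*-suc 2 (count P? xs))))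
  ... | no ¬px = trans (count-reject (P? ∘ proj₁) (cartesianProduct xs _) ¬px) (count-×-Bool P? xs)

open Counting

module Parity where

  open import Data.Integer using (ℤ; +_; -_; _+_; _*_; _-_; ∣_∣; 1ℤ)
  open import Data.Integer.DivMod using (_/ℕ_; _%ℕ_; n%ℕd<d; a≡a%ℕn+[a/ℕn]*n)
  open import Data.Integer.Properties using (abs-*; pos-+; pos-*)
  open import Data.Integer.Tactic.RingSolver using (solve-∀)
  import Data.Nat as ℕ
  import Data.Nat.Properties as ℕ
  open import Data.Sum using (_⊎_; inj₁; inj₂)

  Even Odd : Pred ℤ 0ℓ
  Even i = ∃[ k ] i ≡ + 2 * k
  Odd  i = ∃[ k ] i ≡ + 2 * k + 1ℤ

  even-or-odd : ∀ i → Even i ⊎ Odd i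
  even-or-odd i with i %ℕ 2 | n%ℕd<d i 2 | a≡a%ℕn+[a/ℕn]*n i 2
  ... | 0           | _                   | i≡ = inj₁ (i /ℕ 2 , trans i≡ (lemma (i /ℕ 2)))
    where lemma : ∀ q → + 0 + q * + 2 ≡ + 2 * q
          lemma = solve-∀
  ... | 1           | _                   | i≡ = inj₂ (i /ℕ 2 , trans i≡ (lemma (i /ℕ 2)))
    where lemma : ∀ q → 1ℤ + q * + 2 ≡ + 2 * q + 1ℤ
          lemma = solve-∀
  ... | ℕ.suc (ℕ.suc _) | ℕ.s≤s (ℕ.s≤s ()) | _

  even≢odd : ∀ j k → + 2 * j ≢ + 2 * k + 1ℤ
  even≢odd j k e = ℕ.even≢odd ∣ j - k ∣ 0 (begin
    2 ℕ.* ∣ j - k ∣           ≡⟨ abs-* (+ 2) (j - k) ⟨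
    ∣ + 2 * (j - k) ∣         ≡⟨ cong ∣_∣ (lemma j k) ⟩
    ∣ + 2 * j - + 2 * k ∣     ≡⟨ cong (λ i → ∣ i - + 2 * k ∣) e ⟩
    ∣ + 2 * k + 1ℤ - + 2 * k ∣ ≡⟨ cong ∣_∣ (lemma′ k) ⟩
    1                         ∎)
    where
    open ≡-Reasoning
    lemma : ∀ j k → + 2 * (j - k) ≡ + 2 * j - + 2 * k
    lemma = solve-∀
    lemma′ : ∀ k → + 2 * k + 1ℤ - + 2 * k ≡ 1ℤ
    lemma′ = solve-∀

  even⇒¬odd : ∀ {i} → Even i → ¬ Odd i
  even⇒¬odd (j , refl) (k , e) = even≢odd j k e

  odd? : Decidable Odd
  odd? i with even-or-odd i
  ... | inj₁ ev = no (even⇒¬odd ev)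
  ... | inj₂ od = yes od

  ¬odd⇒even : ∀ {i} → ¬ Odd i → Even i
  ¬odd⇒even {i} ¬od with even-or-odd i
  ... | inj₁ ev = ev
  ... | inj₂ od = contradiction od ¬od

  odd⇒0< : ∀ {m} → Odd (+ m) → 0 ℕ.< m
  odd⇒0< {0}         (k , e) = contradiction e (even≢odd (+ 0) k)
  odd⇒0< {ℕ.suc _} _       = ℕ.s≤s ℕ.z≤n

  odd-square : ∀ {i} → Odd i → ∃[ m ] i * i ≡ + 8 * m + 1ℤ
  odd-square (k , refl) with even-or-odd k
  ... | inj₁ (p , refl) = + 2 * p * p + p , lemma p
    where lemma : ∀ p → (+ 2 * (+ 2 * p) + 1ℤ) * (+ 2 * (+ 2 * p) + 1ℤ) ≡ + 8 * (+ 2 * p * p + p) + 1ℤ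
          lemma = solve-∀
  ... | inj₂ (p , refl) = + 2 * p * p + + 3 * p + 1ℤ , lemma p
    where lemma : ∀ p → (+ 2 * (+ 2 * p + 1ℤ) + 1ℤ) * (+ 2 * (+ 2 * p + 1ℤ) + 1ℤ)
                          ≡ + 8 * (+ 2 * p * p + + 3 * p + 1ℤ) + 1ℤ
          lemma = solve-∀

  odd+even : ∀ {i} → Odd i → ∀ j → Odd (i + + 2 * j)
  odd+even (k , refl) j = k + j , lemma k j
    where lemma : ∀ k j → + 2 * k + 1ℤ + + 2 * j ≡ + 2 * (k + j) + 1ℤ
          lemma = solve-∀

  odd-neg : ∀ {i} → Odd i → Odd (- i)
  odd-neg (k , refl) = - k - 1ℤ , lemma k
    where lemma : ∀ k → - (+ 2 * k + 1ℤ) ≡ + 2 * (- k - 1ℤ) + 1ℤ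
          lemma = solve-∀

  even-pos : ∀ {m} k → m ≡ 2 ℕ.* k → Even (+ m)
  even-pos k refl = + k , pos-* 2 k

  odd-pos : ∀ {m c} q → m ≡ 2 ℕ.* q ℕ.+ c → Odd (+ c) → Odd (+ m)
  odd-pos {c = c} q refl (k , c≡) = + q + k , (begin
    + (2 ℕ.* q ℕ.+ c)     ≡⟨ trans (pos-+ (2 ℕ.* q) c) (cong₂ _+_ (pos-* 2 q) c≡) ⟩
    + 2 * + q + (+ 2 * k + 1ℤ) ≡⟨ lemma (+ q) k ⟩
    + 2 * (+ q + k) + 1ℤ  ∎)
    where
    open ≡-Reasoning
    lemma : ∀ q k → + 2 * q + (+ 2 * k + 1ℤ) ≡ + 2 * (q + k) + 1ℤ
    lemma = solve-∀

open Parity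

module Forms where

  open import Data.Integer using (ℤ; +_; -[1+_]; -_; _+_; _*_; _-_; ∣_∣; 1ℤ)
  open import Data.Integer.Properties using (_≟_; pos-+; pos-*; +-injective; +◃n≡+n)
  open import Data.Integer.Tactic.RingSolver using (solve-∀)
  import Data.Nat as ℕ
  import Data.Nat.Properties as ℕ
  open import Data.List.Properties using (map-cong)
  open import Data.List.Membership.Propositional.Properties using (∈-map⁺; ∈-upTo⁺; ∈-cartesianProduct⁺)
  open import Data.List.Relation.Unary.Unique.Propositional.Properties using (map⁺; upTo⁺)
  open import Relation.Nullary.Decidable using (_×-dec_)

  Triple : Set
  Triple = ℤ × ℤ × ℤ

  cube : List ℤ → List Triple
  cube L = cartesianProduct L (cartesianProduct L L)

  quadForm pronicForm : ℤ → ℤ → ℤ → ℤ → ℤ → ℤ → ℤ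
  quadForm   A B C x y z = A * (x * x) + B * (y * y) + C * (z * z)
  pronicForm A B C x y z = A * (x * (x - 1ℤ)) + B * (y * (y - 1ℤ)) + C * (z * (z - 1ℤ))

  Solution : (ℤ → ℤ → ℤ → ℤ) → ℤ → Pred Triple 0ℓ
  Solution f v (x , y , z) = f x y z ≡ v

  solution? : ∀ f v → Decidable (Solution f v)
  solution? f v (x , y , z) = f x y z ≟ v

  AllOdd OddLast : Pred Triple 0ℓ
  AllOdd  (x , y , z) = Odd x × Odd y × Odd z
  OddLast (_ , _ , z) = Odd z

  allOdd? : Decidable AllOdd
  allOdd? (x , y , z) = odd? x ×-dec odd? y ×-dec odd? z

  oddLast? : Decidable OddLast
  oddLast? (_ , _ , z) = odd? z

  count3≡count : ∀ L f v → count3 L f v ≡ count (solution? f v) (cube L)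
  count3≡count L f v = sym (trans (count-cartesianProduct (solution? f v) L (cartesianProduct L L))
    (cong sum (map-cong (λ x → trans (count-cartesianProduct _ L L)
      (cong sum (map-cong (λ y → sym (sum-indicator _ L)) L))) L)))

  unique-cube : ∀ lo hi → Unique (cube (range lo hi))
  unique-cube lo hi = cartesianProduct⁺ range! (cartesianProduct⁺ range! range!)
    where
    lemma : ∀ i j → i ≡ (i - j) + j
    lemma = solve-∀
    range! : Unique (range lo hi)
    range! = map⁺ (λ {i} {j} e → +-injective
      (trans (lemma (+ i) (+ lo)) (trans (cong (_+ + lo) e) (sym (lemma (+ j) (+ lo)))))) (upTo⁺ _)

  +∈range : ∀ {lo hi k} → k ℕ.≤ hi → + k ∈ range lo hi
  +∈range {lo} {hi} {k} k≤hi =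
    subst (_∈ range lo hi) (trans (cong (_- + lo) (pos-+ lo k)) (lemma (+ lo) (+ k)))
      (∈-map⁺ (λ i → + i - + lo) (∈-upTo⁺ (ℕ.s≤s (ℕ.+-monoʳ-≤ lo k≤hi))))
    where lemma : ∀ l k → l + k - l ≡ k
          lemma = solve-∀

  -∈range : ∀ {lo hi k} → ℕ.suc k ℕ.≤ lo → -[1+ k ] ∈ range lo hi
  -∈range {lo} {hi} {k} k<lo with ℕ.m≤n⇒∃[o]m+o≡n k<lo
  ... | r , refl =
    subst (_∈ range (ℕ.suc k ℕ.+ r) hi) (trans (cong (λ s → + r - s) (pos-+ (ℕ.suc k) r)) (lemma (+ ℕ.suc k) (+ r)))
      (∈-map⁺ (λ i → + i - + (ℕ.suc k ℕ.+ r))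
        (∈-upTo⁺ (ℕ.s≤s (ℕ.≤-trans (ℕ.m≤n+m r (ℕ.suc k)) (ℕ.m≤m+n _ hi)))))
    where lemma : ∀ s r → r - (s + r) ≡ - s
          lemma = solve-∀

  ∈-cube : ∀ {L x y z} → x ∈ L → y ∈ L → z ∈ L → (x , y , z) ∈ cube L
  ∈-cube x∈L y∈L z∈L = ∈-cartesianProduct⁺ x∈L (∈-cartesianProduct⁺ y∈L z∈L)

  square≡ : ∀ x → x * x ≡ + (∣ x ∣ ℕ.* ∣ x ∣)
  square≡ (+ k)    = +◃n≡+n (k ℕ.* k)
  square≡ -[1+ k ] = refl

  pronic≡ : ∀ x → x * (x - 1ℤ) ≡ + (∣ x ∣ ℕ.* ∣ x - 1ℤ ∣)
  pronic≡ (+ 0)       = refl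
  pronic≡ (+ ℕ.suc k) = +◃n≡+n (ℕ.suc k ℕ.* k)
  pronic≡ -[1+ k ]    = refl

  m≤m*m : ∀ m → m ℕ.≤ m ℕ.* m
  m≤m*m 0           = ℕ.z≤n
  m≤m*m (ℕ.suc m) = ℕ.m≤m*n (ℕ.suc m) (ℕ.suc m)

  2m≤m*[1+m] : ∀ m → 2 ℕ.* m ℕ.≤ m ℕ.* ℕ.suc m
  2m≤m*[1+m] 0           = ℕ.z≤n
  2m≤m*[1+m] (ℕ.suc m) = subst (ℕ._≤ ℕ.suc m ℕ.* ℕ.suc (ℕ.suc m)) (ℕ.*-comm (ℕ.suc m) 2)
    (ℕ.*-monoʳ-≤ (ℕ.suc m) (ℕ.s≤s (ℕ.s≤s ℕ.z≤n)))

  square-range : ∀ x {R} → ∣ x ∣ ℕ.* ∣ x ∣ ℕ.≤ R → x ∈ range R R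
  square-range (+ k)    {R} sq≤R = +∈range {R} (ℕ.≤-trans (m≤m*m k) sq≤R)
  square-range -[1+ k ] {R} sq≤R = -∈range {R} (ℕ.≤-trans (m≤m*m (ℕ.suc k)) sq≤R)

  pronic-range : ∀ x {n} → ∣ x ∣ ℕ.* ∣ x - 1ℤ ∣ ℕ.≤ 2 ℕ.* n → x ∈ range n (ℕ.suc n)
  pronic-range (+ 0)       {n} _   = +∈range {n} ℕ.z≤n
  pronic-range (+ ℕ.suc k) {n} p≤n = +∈range {n} (ℕ.s≤s (ℕ.*-cancelˡ-≤ 2
    (ℕ.≤-trans (2m≤m*[1+m] k) (subst (ℕ._≤ 2 ℕ.* n) (ℕ.*-comm (ℕ.suc k) k) p≤n))))
  pronic-range -[1+ k ]    {n} p≤n = -∈range {n} (ℕ.*-cancelˡ-≤ 2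
    (ℕ.≤-trans (2m≤m*[1+m] (ℕ.suc k))
      (subst (λ j → ℕ.suc k ℕ.* ℕ.suc (ℕ.suc j) ℕ.≤ 2 ℕ.* n) (ℕ.+-identityʳ k) p≤n)))

  *-pos : ∀ {m n} → 0 ℕ.< m → 0 ℕ.< n → 0 ℕ.< m ℕ.* n
  *-pos {ℕ.suc m} {ℕ.suc n} _ _ = ℕ.z<s

  diagonal-bound : (φ : ℤ → ℤ) (s : ℤ → ℕ.ℕ) → (∀ x → φ x ≡ + s x) →
    ∀ {c₁ c₂ c₃ R} x y z → 0 ℕ.< c₁ → 0 ℕ.< c₂ → 0 ℕ.< c₃ →
    + c₁ * φ x + + c₂ * φ y + + c₃ * φ z ≡ + R → s x ℕ.≤ R × s y ℕ.≤ R × s z ℕ.≤ R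
  diagonal-bound φ s φ≡s {c₁} {c₂} {c₃} {R} x y z c₁>0 c₂>0 c₃>0 e =
    term≤R c₁>0 (ℕ.≤-trans (ℕ.m≤m+n (c₁ ℕ.* s x) (c₂ ℕ.* s y)) (ℕ.m≤m+n _ (c₃ ℕ.* s z))) ,
    term≤R c₂>0 (ℕ.≤-trans (ℕ.m≤n+m (c₂ ℕ.* s y) (c₁ ℕ.* s x)) (ℕ.m≤m+n _ (c₃ ℕ.* s z))) ,
    term≤R c₃>0 (ℕ.m≤n+m (c₃ ℕ.* s z) (c₁ ℕ.* s x ℕ.+ c₂ ℕ.* s y))
    where
    open ≡-Reasoning
    term : ∀ c w → + (c ℕ.* s w) ≡ + c * φ w
    term c w = trans (pos-* c (s w)) (cong (+ c *_) (sym (φ≡s w)))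
    sum≡R : c₁ ℕ.* s x ℕ.+ c₂ ℕ.* s y ℕ.+ c₃ ℕ.* s z ≡ R
    sum≡R = +-injective (begin
      + (c₁ ℕ.* s x ℕ.+ c₂ ℕ.* s y ℕ.+ c₃ ℕ.* s z)
        ≡⟨ pos-+ (c₁ ℕ.* s x ℕ.+ c₂ ℕ.* s y) (c₃ ℕ.* s z) ⟩
      + (c₁ ℕ.* s x ℕ.+ c₂ ℕ.* s y) + + (c₃ ℕ.* s z)
        ≡⟨ cong (_+ + (c₃ ℕ.* s z)) (pos-+ (c₁ ℕ.* s x) (c₂ ℕ.* s y)) ⟩
      + (c₁ ℕ.* s x) + + (c₂ ℕ.* s y) + + (c₃ ℕ.* s z)
        ≡⟨ cong₂ _+_ (cong₂ _+_ (term c₁ x) (term c₂ y)) (term c₃ z) ⟩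
      + c₁ * φ x + + c₂ * φ y + + c₃ * φ z
        ≡⟨ e ⟩
      + R ∎)
    term≤R : ∀ {c w} → 0 ℕ.< c → c ℕ.* s w ℕ.≤ c₁ ℕ.* s x ℕ.+ c₂ ℕ.* s y ℕ.+ c₃ ℕ.* s z → s w ℕ.≤ R
    term≤R {c} {w} c>0 cs≤ =
      ℕ.≤-trans (ℕ.m≤n*m (s w) c {{ℕ.>-nonZero c>0}}) (ℕ.≤-trans cs≤ (ℕ.≤-reflexive sum≡R))

  quadForm-bound : ∀ {c₁ c₂ c₃} → 0 ℕ.< c₁ → 0 ℕ.< c₂ → 0 ℕ.< c₃ →
    ∀ R t → Solution (quadForm (+ c₁) (+ c₂) (+ c₃)) (+ R) t → t ∈ cube (range R R)
  quadForm-bound c₁>0 c₂>0 c₃>0 R (x , y , z) e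
    with diagonal-bound (λ x → x * x) (λ x → ∣ x ∣ ℕ.* ∣ x ∣) square≡ x y z c₁>0 c₂>0 c₃>0 e
  ... | x≤R , y≤R , z≤R = ∈-cube (square-range x {R} x≤R) (square-range y {R} y≤R) (square-range z {R} z≤R)

  pronicForm-bound : ∀ {c₁ c₂ c₃} → 0 ℕ.< c₁ → 0 ℕ.< c₂ → 0 ℕ.< c₃ →
    ∀ n t → Solution (pronicForm (+ c₁) (+ c₂) (+ c₃)) (+ (2 ℕ.* n)) t → t ∈ cube (range n (ℕ.suc n))
  pronicForm-bound c₁>0 c₂>0 c₃>0 n (x , y , z) e
    with diagonal-bound (λ x → x * (x - 1ℤ)) (λ x → ∣ x ∣ ℕ.* ∣ x - 1ℤ ∣) pronic≡ x y z c₁>0 c₂>0 c₃>0 e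
  ... | x≤2n , y≤2n , z≤2n = ∈-cube (pronic-range x {n} x≤2n) (pronic-range y {n} y≤2n) (pronic-range z {n} z≤2n)

open Forms

module OddSquares where

  open import Data.Integer using (ℤ; +_; -_; _+_; _*_; _-_; 1ℤ)
  open import Data.Integer.Properties using (pos-+; pos-*; *-cancelˡ-≡; +-0-abelianGroup)
  open import Algebra.Properties.AbelianGroup +-0-abelianGroup using (∙-cancelʳ)
  open import Data.Integer.Tactic.RingSolver using (solve-∀)
  import Data.Nat as ℕ
  import Data.Nat.Properties as ℕ

  oddify : Triple → Triple
  oddify (x , y , z) = (+ 2 * x - 1ℤ , + 2 * y - 1ℤ , + 2 * z - 1ℤ)

  quadForm-oddify : ∀ A B C x y z →
    quadForm A B C (+ 2 * x - 1ℤ) (+ 2 * y - 1ℤ) (+ 2 * z - 1ℤ) ≡ + 4 * pronicForm A B C x y z + (A + B + C)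
  quadForm-oddify = identity
    where
    identity : ∀ A B C x y z →
      A * ((+ 2 * x - 1ℤ) * (+ 2 * x - 1ℤ)) + B * ((+ 2 * y - 1ℤ) * (+ 2 * y - 1ℤ)) + C * ((+ 2 * z - 1ℤ) * (+ 2 * z - 1ℤ))
        ≡ + 4 * (A * (x * (x - 1ℤ)) + B * (y * (y - 1ℤ)) + C * (z * (z - 1ℤ))) + (A + B + C)
    identity = solve-∀

  odd-2x-1 : ∀ x → Odd (+ 2 * x - 1ℤ)
  odd-2x-1 x = x - 1ℤ , lemma x
    where lemma : ∀ x → + 2 * x - 1ℤ ≡ + 2 * (x - 1ℤ) + 1ℤ
          lemma = solve-∀

  2x-1-injective : ∀ {x x′} → + 2 * x - 1ℤ ≡ + 2 * x′ - 1ℤ → x ≡ x′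
  2x-1-injective {x} {x′} e = *-cancelˡ-≡ (+ 2) x x′ (∙-cancelʳ (- 1ℤ) _ _ e)

  t3≡count-allOdd : ∀ {a₁ a₂ a₃} n → 0 ℕ.< a₁ → 0 ℕ.< a₂ → 0 ℕ.< a₃ →
    let R = 8 ℕ.* n ℕ.+ (a₁ ℕ.+ a₂ ℕ.+ a₃) in
    t3 a₁ a₂ a₃ n ≡ count (solution? (quadForm (+ a₁) (+ a₂) (+ a₃)) (+ R) ∩? allOdd?) (cube (range R R))
  t3≡count-allOdd {a₁} {a₂} {a₃} n a₁>0 a₂>0 a₃>0 =
    trans (count3≡count (range n (ℕ.suc n)) T (+ (2 ℕ.* n)))
      (count-bijection (solution? T (+ (2 ℕ.* n))) (solution? Q (+ R) ∩? allOdd?)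
        (unique-cube n (ℕ.suc n)) (unique-cube R R) oddify into injective onto)
    where
    R = 8 ℕ.* n ℕ.+ (a₁ ℕ.+ a₂ ℕ.+ a₃)
    T = pronicForm (+ a₁) (+ a₂) (+ a₃)
    Q = quadForm (+ a₁) (+ a₂) (+ a₃)
    S = + a₁ + + a₂ + + a₃
    R≡ : + R ≡ + 4 * + (2 ℕ.* n) + S
    R≡ = begin
      + (8 ℕ.* n ℕ.+ (a₁ ℕ.+ a₂ ℕ.+ a₃))   ≡⟨ pos-+ (8 ℕ.* n) (a₁ ℕ.+ a₂ ℕ.+ a₃) ⟩
      + (8 ℕ.* n) + + (a₁ ℕ.+ a₂ ℕ.+ a₃)  ≡⟨ cong₂ _+_ (trans (cong +_ (ℕ.*-assoc 4 2 n)) (pos-* 4 (2 ℕ.* n)))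
                                                      (trans (pos-+ (a₁ ℕ.+ a₂) a₃) (cong (_+ + a₃) (pos-+ a₁ a₂))) ⟩
      + 4 * + (2 ℕ.* n) + S               ∎
      where open ≡-Reasoning
    oddify-solution : ∀ s → Solution T (+ (2 ℕ.* n)) s ⇔ Solution Q (+ R) (oddify s)
    oddify-solution (x , y , z) = mk⇔
      (λ e → trans (quadForm-oddify (+ a₁) (+ a₂) (+ a₃) x y z) (trans (cong (λ v → + 4 * v + S) e) (sym R≡)))
      (λ e → *-cancelˡ-≡ (+ 4) _ _ (∙-cancelʳ S _ _
        (trans (sym (quadForm-oddify (+ a₁) (+ a₂) (+ a₃) x y z)) (trans e R≡))))
    into : ∀ {t} → t ∈ cube (range n (ℕ.suc n)) → Solution T (+ (2 ℕ.* n)) t →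
           oddify t ∈ cube (range R R) × (Solution Q (+ R) ∩ AllOdd) (oddify t)
    into {t@(x , y , z)} _ e =
      quadForm-bound a₁>0 a₂>0 a₃>0 R (oddify t) sol , sol , odd-2x-1 x , odd-2x-1 y , odd-2x-1 z
      where
      sol : Solution Q (+ R) (oddify t)
      sol = Equivalence.to (oddify-solution t) e
    injective : ∀ {t t′} → Solution T (+ (2 ℕ.* n)) t → Solution T (+ (2 ℕ.* n)) t′ → oddify t ≡ oddify t′ → t ≡ t′
    injective _ _ e = cong₂ _,_ (2x-1-injective (cong proj₁ e))
      (cong₂ _,_ (2x-1-injective (cong (proj₁ ∘ proj₂) e)) (2x-1-injective (cong (proj₂ ∘ proj₂) e)))
    onto : ∀ {t} → t ∈ cube (range R R) → (Solution Q (+ R) ∩ AllOdd) t →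
           ∃[ s ] s ∈ cube (range n (ℕ.suc n)) × Solution T (+ (2 ℕ.* n)) s × oddify s ≡ t
    onto {_ , _ , _} _ (e , (k , refl) , (l , refl) , (m , refl)) =
      s , pronicForm-bound a₁>0 a₂>0 a₃>0 n s sol , sol , oddify-s
      where
      s = (k + 1ℤ , l + 1ℤ , m + 1ℤ)
      shift : ∀ k → + 2 * (k + 1ℤ) - 1ℤ ≡ + 2 * k + 1ℤ
      shift = solve-∀
      oddify-s : oddify s ≡ (+ 2 * k + 1ℤ , + 2 * l + 1ℤ , + 2 * m + 1ℤ)
      oddify-s = cong₂ _,_ (shift k) (cong₂ _,_ (shift l) (shift m))
      sol : Solution T (+ (2 ℕ.* n)) s
      sol = Equivalence.from (oddify-solution s) (subst (Solution Q (+ R)) (sym oddify-s) e)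

open OddSquares

module Quadrupling where

  open import Data.Integer using (ℤ; +_; -_; _+_; _*_; _-_; 1ℤ)
  open import Data.Integer.Properties using (pos-+; pos-*; *-cancelˡ-≡; +-0-abelianGroup)
  open import Algebra.Properties.AbelianGroup +-0-abelianGroup using (∙-cancelʳ)
  open import Data.Integer.Tactic.RingSolver using (solve-∀)
  open import Data.Sum using (inj₁; inj₂)
  import Data.Nat as ℕ
  import Data.Nat.Tactic.RingSolver as ℕ-Solver

  quadruple : Triple × Bool → Triple
  quadruple ((u , v , w) , false) = (u - + 3 * v , u + v , w)
  quadruple ((u , v , w) , true)  = (- u - + 3 * v , u - v , w)

  quadForm-quadruple : ∀ a B u v w β →
    let (X , Y , Z) = quadruple ((u , v , w) , β) in
    quadForm (+ a) (+ (3 ℕ.* a)) B X Y Z ≡ quadForm (+ (4 ℕ.* a)) (+ (12 ℕ.* a)) B u v w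
  quadForm-quadruple a B u v w β = begin
    quadForm (+ a) (+ (3 ℕ.* a)) B X Y Z    ≡⟨ cong (λ c → quadForm (+ a) c B X Y Z) (pos-* 3 a) ⟩
    quadForm (+ a) (+ 3 * + a) B X Y Z      ≡⟨ identity β (+ a) ⟩
    quadForm (+ 4 * + a) (+ 12 * + a) B u v w ≡⟨ cong₂ (λ c₁ c₂ → quadForm c₁ c₂ B u v w) (pos-* 4 a) (pos-* 12 a) ⟨
    quadForm (+ (4 ℕ.* a)) (+ (12 ℕ.* a)) B u v w ∎
    where
    open ≡-Reasoning
    X = proj₁ (quadruple ((u , v , w) , β))
    Y = proj₁ (proj₂ (quadruple ((u , v , w) , β)))
    Z = proj₂ (proj₂ (quadruple ((u , v , w) , β)))
    identity : ∀ β A → let (X , Y , Z) = quadruple ((u , v , w) , β) in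
      quadForm A (+ 3 * A) B X Y Z ≡ quadForm (+ 4 * A) (+ 12 * A) B u v w
    identity false A = lemma A B u v w
      where
      lemma : ∀ A B u v w →
        A * ((u - + 3 * v) * (u - + 3 * v)) + + 3 * A * ((u + v) * (u + v)) + B * (w * w)
          ≡ + 4 * A * (u * u) + + 12 * A * (v * v) + B * (w * w)
      lemma = solve-∀
    identity true A = lemma A B u v w
      where
      lemma : ∀ A B u v w →
        A * ((- u - + 3 * v) * (- u - + 3 * v)) + + 3 * A * ((u - v) * (u - v)) + B * (w * w)
          ≡ + 4 * A * (u * u) + + 12 * A * (v * v) + B * (w * w)
      lemma = solve-∀

  quadruple-allOdd : ∀ {u v w} β → Odd (u + v) → Odd w → AllOdd (quadruple ((u , v , w) , β))
  quadruple-allOdd {u} {v} false odd w-odd =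
    subst Odd (lemma u v) (odd+even odd (- (+ 2 * v))) , odd , w-odd
    where lemma : ∀ u v → u + v + + 2 * (- (+ 2 * v)) ≡ u - + 3 * v
          lemma = solve-∀
  quadruple-allOdd {u} {v} true odd w-odd =
    subst Odd (lemma₁ u v) (odd+even (odd-neg odd) (- v)) , subst Odd (lemma₂ u v) (odd+even odd (- v)) , w-odd
    where lemma₁ : ∀ u v → - (u + v) + + 2 * (- v) ≡ - u - + 3 * v
          lemma₁ = solve-∀
          lemma₂ : ∀ u v → u + v + + 2 * (- v) ≡ u - v
          lemma₂ = solve-∀

  scaledPreimage : Bool → Triple → Triple
  scaledPreimage false (X , Y , Z) = (X + + 3 * Y , Y - X , + 4 * Z)
  scaledPreimage true  (X , Y , Z) = (+ 3 * Y - X , - (X + Y) , + 4 * Z)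

  scaledPreimage-quadruple : ∀ β u v w → scaledPreimage β (quadruple ((u , v , w) , β)) ≡ (+ 4 * u , + 4 * v , + 4 * w)
  scaledPreimage-quadruple false u v w = cong₂ _,_ (lemma₁ u v) (cong₂ _,_ (lemma₂ u v) refl)
    where lemma₁ : ∀ u v → u - + 3 * v + + 3 * (u + v) ≡ + 4 * u
          lemma₁ = solve-∀
          lemma₂ : ∀ u v → u + v - (u - + 3 * v) ≡ + 4 * v
          lemma₂ = solve-∀
  scaledPreimage-quadruple true u v w = cong₂ _,_ (lemma₁ u v) (cong₂ _,_ (lemma₂ u v) refl)
    where lemma₁ : ∀ u v → + 3 * (u - v) - (- u - + 3 * v) ≡ + 4 * u
          lemma₁ = solve-∀
          lemma₂ : ∀ u v → - (- u - + 3 * v + (u - v)) ≡ + 4 * v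
          lemma₂ = solve-∀

  quadruple-injective : ∀ β {e e′} → quadruple (e , β) ≡ quadruple (e′ , β) → e ≡ e′
  quadruple-injective β {u , v , w} {u′ , v′ , w′} eq =
    cong₂ _,_ (cancel (cong proj₁ 4e≡4e′))
      (cong₂ _,_ (cancel (cong (proj₁ ∘ proj₂) 4e≡4e′)) (cancel (cong (proj₂ ∘ proj₂) 4e≡4e′)))
    where
    cancel : ∀ {i j} → + 4 * i ≡ + 4 * j → i ≡ j
    cancel = *-cancelˡ-≡ (+ 4) _ _
    4e≡4e′ : (+ 4 * u , + 4 * v , + 4 * w) ≡ (+ 4 * u′ , + 4 * v′ , + 4 * w′)
    4e≡4e′ = trans (sym (scaledPreimage-quadruple β u v w))
               (trans (cong (scaledPreimage β) eq) (scaledPreimage-quadruple β u′ v′ w′))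

  quadruple-false≢true : ∀ {u v w u′ v′ w′} → Odd (u′ + v′) →
    quadruple ((u , v , w) , false) ≢ quadruple ((u′ , v′ , w′) , true)
  quadruple-false≢true {u} {v} {w} {u′} {v′} {w′} odd eq = even⇒¬odd (v , *-cancelˡ-≡ (+ 2) _ _ (begin
    + 2 * (u′ + v′)                             ≡⟨ lemma₁ u′ v′ ⟩
    gap (quadruple ((u′ , v′ , w′) , true))     ≡⟨ cong gap eq ⟨
    gap (quadruple ((u , v , w) , false))       ≡⟨ lemma₂ u v ⟩
    + 2 * (+ 2 * v)                             ∎)) odd
    where
    open ≡-Reasoning
    gap : Triple → ℤ
    gap (X , Y , _) = Y - X
    lemma₁ : ∀ u v → + 2 * (u + v) ≡ u - v - (- u - + 3 * v)
    lemma₁ = solve-∀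
    lemma₂ : ∀ u v → u + v - (u - + 3 * v) ≡ + 2 * (+ 2 * v)
    lemma₂ = solve-∀

  -- Since w² ≡ 1 (mod 8), an even u + v would make 4A ≡ 0 (mod 8).
  solution⇒odd-u+v : ∀ {A B N u v w} → Odd A → Odd w →
    quadForm (+ 4 * A) (+ 12 * A) B u v w ≡ + 8 * N + + 4 * A + B → Odd (u + v)
  solution⇒odd-u+v {A} {B} {N} {u} {v} {w} (α , refl) w-odd e with even-or-odd (u + v)
  ... | inj₂ odd = odd
  ... | inj₁ (q , u+v≡) with odd-square w-odd
  ...   | m , w²≡ = contradiction
    (*-cancelˡ-≡ (+ 4) _ _ (∙-cancelʳ B _ _ (trans (sym value≡) (trans e target≡)))) (even≢odd X (N + α))
    where
    open ≡-Reasoning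
    A′ = + 2 * α + 1ℤ
    s = q * q - q * v + v * v
    X = + 2 * A′ * s + B * m
    u≡ : u ≡ + 2 * q - v
    u≡ = trans (lemma u v) (cong (_- v) u+v≡)
      where lemma : ∀ u v → u ≡ u + v - v
            lemma = solve-∀
    value≡ : quadForm (+ 4 * A′) (+ 12 * A′) B u v w ≡ + 4 * (+ 2 * X) + B
    value≡ = begin
      quadForm (+ 4 * A′) (+ 12 * A′) B u v w            ≡⟨ cong (λ u → quadForm (+ 4 * A′) (+ 12 * A′) B u v w) u≡ ⟩
      quadForm (+ 4 * A′) (+ 12 * A′) B (+ 2 * q - v) v w ≡⟨ lemma₁ A′ B q v w ⟩
      + 16 * A′ * s + B * (w * w)                        ≡⟨ cong (λ t → + 16 * A′ * s + B * t) w²≡ ⟩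
      + 16 * A′ * s + B * (+ 8 * m + 1ℤ)                 ≡⟨ lemma₂ A′ B s m ⟩
      + 4 * (+ 2 * X) + B                                ∎
      where
      lemma₁ : ∀ A B q v w → (+ 4 * A) * ((+ 2 * q - v) * (+ 2 * q - v)) + (+ 12 * A) * (v * v) + B * (w * w)
                               ≡ + 16 * A * (q * q - q * v + v * v) + B * (w * w)
      lemma₁ = solve-∀
      lemma₂ : ∀ A B s m → + 16 * A * s + B * (+ 8 * m + 1ℤ) ≡ + 4 * (+ 2 * (+ 2 * A * s + B * m)) + B
      lemma₂ = solve-∀
    target≡ : + 8 * N + + 4 * A′ + B ≡ + 4 * (+ 2 * (N + α) + 1ℤ) + B
    target≡ = lemma N α B
      where lemma : ∀ N α B → + 8 * N + + 4 * (+ 2 * α + 1ℤ) + B ≡ + 4 * (+ 2 * (N + α) + 1ℤ) + B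
            lemma = solve-∀

  solution⇒odd-u+v′ : ∀ {a b} n {u v w} → Odd (+ a) →
    Solution (quadForm (+ (4 ℕ.* a)) (+ (12 ℕ.* a)) (+ b)) (+ (8 ℕ.* n ℕ.+ 4 ℕ.* a ℕ.+ b)) (u , v , w) → Odd w → Odd (u + v)
  solution⇒odd-u+v′ {a} {b} n {u} {v} {w} odd-a e w-odd = solution⇒odd-u+v {+ a} {+ b} {+ n} {u} {v} {w} odd-a w-odd (begin
    quadForm (+ 4 * + a) (+ 12 * + a) (+ b) u v w
      ≡⟨ cong₂ (λ c₁ c₂ → quadForm c₁ c₂ (+ b) u v w) (pos-* 4 a) (pos-* 12 a) ⟨
    quadForm (+ (4 ℕ.* a)) (+ (12 ℕ.* a)) (+ b) u v w   ≡⟨ e ⟩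
    + (8 ℕ.* n ℕ.+ 4 ℕ.* a ℕ.+ b)                       ≡⟨ pos-+ (8 ℕ.* n ℕ.+ 4 ℕ.* a) b ⟩
    + (8 ℕ.* n ℕ.+ 4 ℕ.* a) + + b                       ≡⟨ cong (_+ + b) (pos-+ (8 ℕ.* n) (4 ℕ.* a)) ⟩
    + (8 ℕ.* n) + + (4 ℕ.* a) + + b                     ≡⟨ cong₂ (λ i j → i + j + + b) (pos-* 8 n) (pos-* 4 a) ⟩
    + 8 * + n + + 4 * + a + + b                         ∎)
    where open ≡-Reasoning

  i-j≡k⇒i≡j+k : ∀ {i j k} → i - j ≡ k → i ≡ j + k
  i-j≡k⇒i≡j+k {i} {j} refl = lemma i j
    where lemma : ∀ i j → i ≡ j + (i - j)
          lemma = solve-∀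

  quadruple-surjective : ∀ {X Y} Z → Odd X → Odd Y → ∃[ u ] ∃[ v ] ∃[ β ] quadruple ((u , v , Z) , β) ≡ (X , Y , Z)
  quadruple-surjective Z (k , refl) (l , refl) with even-or-odd (l - k)
  ... | inj₁ (j , l-k≡2j) = + 2 * k + + 3 * j + 1ℤ , j , false ,
    cong₂ _,_ (lemma₁ k j)
      (cong₂ _,_ (trans (lemma₂ k j) (cong (λ m → + 2 * m + 1ℤ) (sym (i-j≡k⇒i≡j+k {l} {k} l-k≡2j)))) refl)
    where
    lemma₁ : ∀ k j → + 2 * k + + 3 * j + 1ℤ - + 3 * j ≡ + 2 * k + 1ℤ
    lemma₁ = solve-∀
    lemma₂ : ∀ k j → + 2 * k + + 3 * j + 1ℤ + j ≡ + 2 * (k + + 2 * j) + 1ℤ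
    lemma₂ = solve-∀
  ... | inj₂ (j , l-k≡2j+1) = k + + 3 * j + + 2 , - (k + j + 1ℤ) , true ,
    cong₂ _,_ (lemma₁ k j)
      (cong₂ _,_ (trans (lemma₂ k j) (cong (λ m → + 2 * m + 1ℤ) (sym (i-j≡k⇒i≡j+k {l} {k} l-k≡2j+1)))) refl)
    where
    lemma₁ : ∀ k j → - (k + + 3 * j + + 2) - + 3 * (- (k + j + 1ℤ)) ≡ + 2 * k + 1ℤ
    lemma₁ = solve-∀
    lemma₂ : ∀ k j → k + + 3 * j + + 2 - (- (k + j + 1ℤ)) ≡ + 2 * (k + (+ 2 * j + 1ℤ)) + 1ℤ
    lemma₂ = solve-∀

  unique-bools : Unique (true ∷ false ∷ [])
  unique-bools = ((λ ()) ∷ []) ∷ [] ∷ []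

  ∈-bools : ∀ β → β ∈ true ∷ false ∷ []
  ∈-bools true  = here refl
  ∈-bools false = there (here refl)

  count-allOdd≡2*count-oddLast : ∀ {a b} n → Odd (+ a) → 0 ℕ.< b →
    let R = 8 ℕ.* n ℕ.+ 4 ℕ.* a ℕ.+ b in
    count (solution? (quadForm (+ a) (+ (3 ℕ.* a)) (+ b)) (+ R) ∩? allOdd?) (cube (range R R))
      ≡ 2 ℕ.* count (solution? (quadForm (+ (4 ℕ.* a)) (+ (12 ℕ.* a)) (+ b)) (+ R) ∩? oddLast?) (cube (range R R))
  count-allOdd≡2*count-oddLast {a} {b} n odd-a b>0 =
    trans (sym (count-bijection (W? ∘ proj₁) (solution? S (+ R) ∩? allOdd?)
                  (cartesianProduct⁺ (unique-cube R R) unique-bools) (unique-cube R R) quadruple into injective onto))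
          (count-×-Bool W? (cube (range R R)))
    where
    R = 8 ℕ.* n ℕ.+ 4 ℕ.* a ℕ.+ b
    S = quadForm (+ a) (+ (3 ℕ.* a)) (+ b)
    E = quadForm (+ (4 ℕ.* a)) (+ (12 ℕ.* a)) (+ b)
    W? = solution? E (+ R) ∩? oddLast?
    a>0 : 0 ℕ.< a
    a>0 = odd⇒0< odd-a
    odd-u+v : ∀ {u v w} → Solution E (+ R) (u , v , w) → Odd w → Odd (u + v)
    odd-u+v {u} {v} {w} = solution⇒odd-u+v′ n {u} {v} {w} odd-a
    into : ∀ {eβ} → eβ ∈ cartesianProduct (cube (range R R)) (true ∷ false ∷ []) →
           (Solution E (+ R) ∩ OddLast) (proj₁ eβ) →
           quadruple eβ ∈ cube (range R R) × (Solution S (+ R) ∩ AllOdd) (quadruple eβ)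
    into {(u , v , w) , β} _ (e , w-odd) =
      quadForm-bound a>0 (*-pos {3} ℕ.z<s a>0) b>0 R (quadruple ((u , v , w) , β)) sol , sol ,
      quadruple-allOdd β (odd-u+v {u} {v} {w} e w-odd) w-odd
      where
      sol : Solution S (+ R) (quadruple ((u , v , w) , β))
      sol = trans (quadForm-quadruple a (+ b) u v w β) e
    injective : ∀ {eβ eβ′} → (Solution E (+ R) ∩ OddLast) (proj₁ eβ) → (Solution E (+ R) ∩ OddLast) (proj₁ eβ′) →
                quadruple eβ ≡ quadruple eβ′ → eβ ≡ eβ′
    injective {_ , false} {_ , false} _ _ eq = cong (_, false) (quadruple-injective false eq)
    injective {_ , true}  {_ , true}  _ _ eq = cong (_, true) (quadruple-injective true eq)
    injective {(u , v , w) , false} {(u′ , v′ , w′) , true} _ (e′ , w′-odd) eq =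
      contradiction eq (quadruple-false≢true {u} {v} {w} {u′} {v′} {w′} (odd-u+v {u′} {v′} {w′} e′ w′-odd))
    injective {(u , v , w) , true} {(u′ , v′ , w′) , false} (e , w-odd) _ eq =
      contradiction (sym eq) (quadruple-false≢true {u′} {v′} {w′} {u} {v} {w} (odd-u+v {u} {v} {w} e w-odd))
    onto : ∀ {t} → t ∈ cube (range R R) → (Solution S (+ R) ∩ AllOdd) t →
           ∃[ eβ ] eβ ∈ cartesianProduct (cube (range R R)) (true ∷ false ∷ []) ×
                   (Solution E (+ R) ∩ OddLast) (proj₁ eβ) × quadruple eβ ≡ t
    onto {X , Y , Z} _ (e , X-odd , Y-odd , Z-odd) with quadruple-surjective Z X-odd Y-odd
    ... | u , v , β , eq =
      ((u , v , Z) , β) ,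
      ∈-cartesianProduct⁺ (quadForm-bound (*-pos {4} ℕ.z<s a>0) (*-pos {12} ℕ.z<s a>0) b>0 R (u , v , Z) sol) (∈-bools β) ,
      (sol , Z-odd) , eq
      where
      sol : Solution E (+ R) (u , v , Z)
      sol = trans (sym (quadForm-quadruple a (+ b) u v Z β)) (subst (Solution S (+ R)) (sym eq) e)

  t3≡2*count-oddLast : ∀ {a b} n → Odd (+ a) → 0 ℕ.< b →
    let R = 8 ℕ.* n ℕ.+ 4 ℕ.* a ℕ.+ b in
    t3 a (3 ℕ.* a) b n
      ≡ 2 ℕ.* count (solution? (quadForm (+ (4 ℕ.* a)) (+ (12 ℕ.* a)) (+ b)) (+ R) ∩? oddLast?) (cube (range R R))
  t3≡2*count-oddLast {a} {b} n odd-a b>0 = begin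
    t3 a (3 ℕ.* a) b n                          ≡⟨ t3≡count-allOdd n a>0 (*-pos {3} ℕ.z<s a>0) b>0 ⟩
    count (oddSolution? R′) (cube (range R′ R′)) ≡⟨ cong (λ R → count (oddSolution? R) (cube (range R R))) R≡ ⟩
    count (oddSolution? R) (cube (range R R))   ≡⟨ count-allOdd≡2*count-oddLast n odd-a b>0 ⟩
    2 ℕ.* count W? (cube (range R R))           ∎
    where
    open ≡-Reasoning
    R′ = 8 ℕ.* n ℕ.+ (a ℕ.+ 3 ℕ.* a ℕ.+ b)
    R = 8 ℕ.* n ℕ.+ 4 ℕ.* a ℕ.+ b
    W? = solution? (quadForm (+ (4 ℕ.* a)) (+ (12 ℕ.* a)) (+ b)) (+ R) ∩? oddLast?
    a>0 : 0 ℕ.< a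
    a>0 = odd⇒0< odd-a
    oddSolution? : ∀ R → Decidable (Solution (quadForm (+ a) (+ (3 ℕ.* a)) (+ b)) (+ R) ∩ AllOdd)
    oddSolution? R = solution? (quadForm (+ a) (+ (3 ℕ.* a)) (+ b)) (+ R) ∩? allOdd?
    R≡ : 8 ℕ.* n ℕ.+ (a ℕ.+ 3 ℕ.* a ℕ.+ b) ≡ 8 ℕ.* n ℕ.+ 4 ℕ.* a ℕ.+ b
    R≡ = lemma n a b
      where lemma : ∀ n a b → 8 ℕ.* n ℕ.+ (a ℕ.+ 3 ℕ.* a ℕ.+ b) ≡ 8 ℕ.* n ℕ.+ 4 ℕ.* a ℕ.+ b
            lemma = ℕ-Solver.solve-∀

open Quadrupling

module Rescaling where

  open import Data.Integer using (ℤ; +_; _+_; _*_; _-_)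
  open import Data.Integer.Properties using (pos-+; pos-*; *-cancelˡ-≡)
  open import Data.Integer.Tactic.RingSolver using (solve-∀)
  import Data.Nat as ℕ
  open import Data.Sum using (inj₁; inj₂)

  m≡k+n⇒+k≡+m-+n : ∀ {m k n} → m ≡ k ℕ.+ n → + k ≡ + m - + n
  m≡k+n⇒+k≡+m-+n {k = k} {n} refl = trans (lemma (+ k) (+ n)) (cong (_- + n) (sym (pos-+ k n)))
    where lemma : ∀ i j → i ≡ i + j - j
          lemma = solve-∀

  solution⇒odd-last : ∀ {A B C V} t → Even A → Even B → Odd V → Solution (quadForm A B C) V t → OddLast t
  solution⇒odd-last {C = C} (x , y , z) (α , refl) (β , refl) odd-V e with even-or-odd z
  ... | inj₂ odd-z    = odd-z
  ... | inj₁ (k , refl) = contradiction odd-V (even⇒¬odd (_ , trans (sym e) (lemma α β C x y k)))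
    where
    lemma : ∀ α β C x y k → + 2 * α * (x * x) + + 2 * β * (y * y) + C * ((+ 2 * k) * (+ 2 * k))
                              ≡ + 2 * (α * (x * x) + β * (y * y) + + 2 * C * (k * k))
    lemma = solve-∀

  solution-scale : ∀ {k} → 0 ℕ.< k → ∀ {a₁ a₂ a₃ b₁ b₂ b₃ m r} →
    b₁ ≡ k ℕ.* a₁ → b₂ ≡ k ℕ.* a₂ → b₃ ≡ k ℕ.* a₃ → r ≡ k ℕ.* m →
    ∀ t → Solution (quadForm (+ b₁) (+ b₂) (+ b₃)) (+ r) t ⇔ Solution (quadForm (+ a₁) (+ a₂) (+ a₃)) (+ m) t
  solution-scale {k} k>0 {a₁} {a₂} {a₃} {m = m} refl refl refl refl (x , y , z) = mk⇔
    (λ e → *-cancelˡ-≡ (+ k) _ _ {{ℕ.>-nonZero k>0}} (trans (sym scaled) (trans e (pos-* k m))))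
    (λ e → trans scaled (trans (cong (+ k *_) e) (sym (pos-* k m))))
    where
    lemma : ∀ K A B C x y z → K * A * (x * x) + K * B * (y * y) + K * C * (z * z) ≡ K * (A * (x * x) + B * (y * y) + C * (z * z))
    lemma = solve-∀
    scaled : quadForm (+ (k ℕ.* a₁)) (+ (k ℕ.* a₂)) (+ (k ℕ.* a₃)) x y z ≡ + k * quadForm (+ a₁) (+ a₂) (+ a₃) x y z
    scaled = trans (cong₂ (λ c₁ c₂ → quadForm c₁ c₂ (+ (k ℕ.* a₃)) x y z) (pos-* k a₁) (pos-* k a₂))
                   (trans (cong (λ c₃ → quadForm (+ k * + a₁) (+ k * + a₂) c₃ x y z) (pos-* k a₃))
                          (lemma (+ k) (+ a₁) (+ a₂) (+ a₃) x y z))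

  solution-double : ∀ A B d V u v k →
    Solution (quadForm A B (+ (4 ℕ.* d))) V (u , v , k) ⇔ Solution (quadForm A B (+ d)) V (u , v , + 2 * k)
  solution-double A B d V u v k = mk⇔ (trans doubled) (trans (sym doubled))
    where
    lemma : ∀ A B D u v k → A * (u * u) + B * (v * v) + D * ((+ 2 * k) * (+ 2 * k)) ≡ A * (u * u) + B * (v * v) + + 4 * D * (k * k)
    lemma = solve-∀
    doubled : quadForm A B (+ d) u v (+ 2 * k) ≡ quadForm A B (+ (4 ℕ.* d)) u v k
    doubled = trans (lemma A B (+ d) u v k) (cong (λ c → quadForm A B c u v k) (sym (pos-* 4 d)))

  count-oddLast≡count : ∀ {a₁ a₂ a₃ m} → 0 ℕ.< a₁ → 0 ℕ.< a₂ → 0 ℕ.< a₃ → Even (+ a₁) → Even (+ a₂) → Odd (+ m) →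
    count (solution? (quadForm (+ a₁) (+ a₂) (+ a₃)) (+ m) ∩? oddLast?) (cube (range m m))
      ≡ count (solution? (quadForm (+ a₁) (+ a₂) (+ a₃)) (+ m)) (cube (range m m))
  count-oddLast≡count {a₁} {a₂} {a₃} {m} a₁>0 a₂>0 a₃>0 even₁ even₂ odd-m =
    count-≐ (solution? F (+ m) ∩? oddLast?) (solution? F (+ m)) (unique-cube m m) (unique-cube m m)
      (λ {t} → bound t ∘ proj₁) (λ {t} → bound t)
      (proj₁ , λ {t} e → e , solution⇒odd-last {C = + a₃} t even₁ even₂ odd-m e)
    where
    F = quadForm (+ a₁) (+ a₂) (+ a₃)
    bound : ∀ t → Solution F (+ m) t → t ∈ cube (range m m)
    bound = quadForm-bound a₁>0 a₂>0 a₃>0 m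

  count-scale : ∀ {k} → 0 ℕ.< k → ∀ {a₁ a₂ a₃ b₁ b₂ b₃ m r} → 0 ℕ.< a₁ → 0 ℕ.< a₂ → 0 ℕ.< a₃ →
    b₁ ≡ k ℕ.* a₁ → b₂ ≡ k ℕ.* a₂ → b₃ ≡ k ℕ.* a₃ → r ≡ k ℕ.* m →
    count (solution? (quadForm (+ b₁) (+ b₂) (+ b₃)) (+ r) ∩? oddLast?) (cube (range r r))
      ≡ count (solution? (quadForm (+ a₁) (+ a₂) (+ a₃)) (+ m) ∩? oddLast?) (cube (range m m))
  count-scale {k} k>0 {a₁} {a₂} {a₃} {m = m} {r} a₁>0 a₂>0 a₃>0 refl refl refl r≡ =
    count-≐ (solution? G (+ r) ∩? oddLast?) (solution? F (+ m) ∩? oddLast?) (unique-cube r r) (unique-cube m m)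
      (λ {t} → quadForm-bound a₁>0 a₂>0 a₃>0 m t ∘ to (scale t) ∘ proj₁)
      (λ {t} → quadForm-bound (*-pos k>0 a₁>0) (*-pos k>0 a₂>0) (*-pos k>0 a₃>0) r t ∘ from (scale t) ∘ proj₁)
      ((λ {t} (e , odd) → to (scale t) e , odd) , (λ {t} (e , odd) → from (scale t) e , odd))
    where
    open Equivalence
    F = quadForm (+ a₁) (+ a₂) (+ a₃)
    G = quadForm (+ (k ℕ.* a₁)) (+ (k ℕ.* a₂)) (+ (k ℕ.* a₃))
    scale : ∀ t → Solution G (+ r) t ⇔ Solution F (+ m) t
    scale = solution-scale k>0 refl refl refl r≡

  count-evenLast : ∀ {a₁ a₂ d} m → 0 ℕ.< a₁ → 0 ℕ.< a₂ → 0 ℕ.< d →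
    count (solution? (quadForm (+ a₁) (+ a₂) (+ (4 ℕ.* d))) (+ m)) (cube (range m m))
      ≡ count (solution? (quadForm (+ a₁) (+ a₂) (+ d)) (+ m) ∩? ∁? oddLast?) (cube (range m m))
  count-evenLast {a₁} {a₂} {d} m a₁>0 a₂>0 d>0 =
    count-bijection (solution? G (+ m)) (solution? F (+ m) ∩? ∁? oddLast?) (unique-cube m m) (unique-cube m m)
      double into injective onto
    where
    open Equivalence
    F = quadForm (+ a₁) (+ a₂) (+ d)
    G = quadForm (+ a₁) (+ a₂) (+ (4 ℕ.* d))
    double : Triple → Triple
    double (u , v , k) = (u , v , + 2 * k)
    into : ∀ {t} → t ∈ cube (range m m) → Solution G (+ m) t →
           double t ∈ cube (range m m) × (Solution F (+ m) ∩ ∁ OddLast) (double t)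
    into {u , v , k} _ e = quadForm-bound a₁>0 a₂>0 d>0 m (double (u , v , k)) sol , sol , even⇒¬odd (k , refl)
      where
      sol : Solution F (+ m) (u , v , + 2 * k)
      sol = to (solution-double (+ a₁) (+ a₂) d (+ m) u v k) e
    injective : ∀ {t t′} → Solution G (+ m) t → Solution G (+ m) t′ → double t ≡ double t′ → t ≡ t′
    injective _ _ eq = cong₂ _,_ (cong proj₁ eq)
      (cong₂ _,_ (cong (proj₁ ∘ proj₂) eq) (*-cancelˡ-≡ (+ 2) _ _ (cong (proj₂ ∘ proj₂) eq)))
    onto : ∀ {t} → t ∈ cube (range m m) → (Solution F (+ m) ∩ ∁ OddLast) t →
           ∃[ s ] s ∈ cube (range m m) × Solution G (+ m) s × double s ≡ t
    onto {u , v , w} _ (e , ¬odd) with ¬odd⇒even ¬odd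
    ... | k , refl = (u , v , k) , quadForm-bound a₁>0 a₂>0 (*-pos {4} ℕ.z<s d>0) m (u , v , k) sol , sol , refl
      where
      sol : Solution G (+ m) (u , v , k)
      sol = from (solution-double (+ a₁) (+ a₂) d (+ m) u v k) e

open Rescaling

open import Data.Nat using (ℕ; _+_; _*_; _/_; _%_; _>_)
open import Data.Integer using (ℤ; +_; _-_)
open import Data.Nat.DivMod using (m≡m%n+[m/n]*n; m*n/n≡m)
import Data.Nat as ℕ
import Data.Nat.Properties as ℕ
import Data.Nat.Tactic.RingSolver as ℕ-Solver

t3-odd : ∀ a b n → Odd (+ a) → Odd (+ b) →
  t3 a (3 * a) b n ≡ 2 * N3 (4 * a) (12 * a) b (8 * n + 4 * a + b)
t3-odd a b n odd-a odd-b = begin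
  t3 a (3 * a) b n                                  ≡⟨ t3≡2*count-oddLast n odd-a b>0 ⟩
  2 * count (solution? F (+ R) ∩? oddLast?) box     ≡⟨ cong (2 *_) (count-oddLast≡count 4a>0 12a>0 b>0
                                                         (even-pos (2 * a) (lemma₁ a)) (even-pos (6 * a) (lemma₂ a))
                                                         (odd-pos (4 * n + 2 * a) (lemma₃ n a b) odd-b)) ⟩
  2 * count (solution? F (+ R)) box                 ≡⟨ cong (2 *_) (count3≡count (range R R) F (+ R)) ⟨
  2 * N3 (4 * a) (12 * a) b R                       ∎
  where
  open ≡-Reasoning
  R = 8 * n + 4 * a + b
  F = quadForm (+ (4 * a)) (+ (12 * a)) (+ b)
  box = cube (range R R)
  b>0 : 0 ℕ.< b
  b>0 = odd⇒0< odd-b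
  4a>0 : 0 ℕ.< 4 * a
  4a>0 = *-pos {4} ℕ.z<s (odd⇒0< odd-a)
  12a>0 : 0 ℕ.< 12 * a
  12a>0 = *-pos {12} ℕ.z<s (odd⇒0< odd-a)
  lemma₁ : ∀ a → 4 * a ≡ 2 * (2 * a)
  lemma₁ = ℕ-Solver.solve-∀
  lemma₂ : ∀ a → 12 * a ≡ 2 * (6 * a)
  lemma₂ = ℕ-Solver.solve-∀
  lemma₃ : ∀ n a b → 8 * n + 4 * a + b ≡ 2 * (4 * n + 2 * a) + b
  lemma₃ = ℕ-Solver.solve-∀

t3-2mod4 : ∀ a c n → Odd (+ a) → Odd (+ c) →
  t3 a (3 * a) (2 * c) n ≡ 2 * N3 (2 * a) (6 * a) c (4 * n + 2 * a + c)
t3-2mod4 a c n odd-a odd-c = begin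
  t3 a (3 * a) (2 * c) n                            ≡⟨ t3≡2*count-oddLast n odd-a (*-pos {2} ℕ.z<s c>0) ⟩
  2 * count (solution? G (+ R) ∩? oddLast?) (cube (range R R))
    ≡⟨ cong (2 *_) (count-scale {2} ℕ.z<s 2a>0 6a>0 c>0 (lemma₁ a) (lemma₂ a) refl (lemma₃ n a c)) ⟩
  2 * count (solution? F (+ M) ∩? oddLast?) box     ≡⟨ cong (2 *_) (count-oddLast≡count 2a>0 6a>0 c>0
                                                         (even-pos a refl) (even-pos (3 * a) (lemma₄ a))
                                                         (odd-pos (2 * n + a) (lemma₅ n a c) odd-c)) ⟩
  2 * count (solution? F (+ M)) box                 ≡⟨ cong (2 *_) (count3≡count (range M M) F (+ M)) ⟨
  2 * N3 (2 * a) (6 * a) c M                        ∎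
  where
  open ≡-Reasoning
  R = 8 * n + 4 * a + 2 * c
  M = 4 * n + 2 * a + c
  G = quadForm (+ (4 * a)) (+ (12 * a)) (+ (2 * c))
  F = quadForm (+ (2 * a)) (+ (6 * a)) (+ c)
  box = cube (range M M)
  c>0 : 0 ℕ.< c
  c>0 = odd⇒0< odd-c
  2a>0 : 0 ℕ.< 2 * a
  2a>0 = *-pos {2} ℕ.z<s (odd⇒0< odd-a)
  6a>0 : 0 ℕ.< 6 * a
  6a>0 = *-pos {6} ℕ.z<s (odd⇒0< odd-a)
  lemma₁ : ∀ a → 4 * a ≡ 2 * (2 * a)
  lemma₁ = ℕ-Solver.solve-∀
  lemma₂ : ∀ a → 12 * a ≡ 2 * (6 * a)
  lemma₂ = ℕ-Solver.solve-∀
  lemma₃ : ∀ n a c → 8 * n + 4 * a + 2 * c ≡ 2 * (4 * n + 2 * a + c)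
  lemma₃ = ℕ-Solver.solve-∀
  lemma₄ : ∀ a → 6 * a ≡ 2 * (3 * a)
  lemma₄ = ℕ-Solver.solve-∀
  lemma₅ : ∀ n a c → 4 * n + 2 * a + c ≡ 2 * (2 * n + a) + c
  lemma₅ = ℕ-Solver.solve-∀

t3-0mod4 : ∀ a d n → Odd (+ a) → 0 ℕ.< d →
  let M = 2 * n + a + d in
  + t3 a (3 * a) (4 * d) n ≡ + (2 * N3 a (3 * a) d M) - + (2 * N3 a (3 * a) (4 * d) M)
t3-0mod4 a d n odd-a d>0 = m≡k+n⇒+k≡+m-+n (begin
  2 * N3 a (3 * a) d M                 ≡⟨ cong (2 *_) N₁≡ ⟩
  2 * (O + E)                          ≡⟨ ℕ.*-distribˡ-+ 2 O E ⟩
  2 * O + 2 * E                        ≡⟨ cong (λ t → t + 2 * E) t3≡ ⟨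
  t3 a (3 * a) (4 * d) n + 2 * E       ≡⟨ cong (λ x → t3 a (3 * a) (4 * d) n + 2 * x) N₂≡ ⟨
  t3 a (3 * a) (4 * d) n + 2 * N3 a (3 * a) (4 * d) M ∎)
  where
  open ≡-Reasoning
  R = 8 * n + 4 * a + 4 * d
  M = 2 * n + a + d
  F = quadForm (+ a) (+ (3 * a)) (+ d)
  box = cube (range M M)
  O = count (solution? F (+ M) ∩? oddLast?) box
  E = count (solution? F (+ M) ∩? ∁? oddLast?) box
  a>0 : 0 ℕ.< a
  a>0 = odd⇒0< odd-a
  3a>0 : 0 ℕ.< 3 * a
  3a>0 = *-pos {3} ℕ.z<s a>0
  lemma₁ : ∀ a → 12 * a ≡ 4 * (3 * a)
  lemma₁ = ℕ-Solver.solve-∀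
  lemma₂ : ∀ n a d → 8 * n + 4 * a + 4 * d ≡ 4 * (2 * n + a + d)
  lemma₂ = ℕ-Solver.solve-∀
  t3≡ : t3 a (3 * a) (4 * d) n ≡ 2 * O
  t3≡ = trans (t3≡2*count-oddLast n odd-a (*-pos {4} ℕ.z<s d>0))
              (cong (2 *_) (count-scale {4} ℕ.z<s a>0 3a>0 d>0 refl (lemma₁ a) refl (lemma₂ n a d)))
  N₁≡ : N3 a (3 * a) d M ≡ O + E
  N₁≡ = trans (count3≡count (range M M) F (+ M)) (count-split (solution? F (+ M)) oddLast? box)
  N₂≡ : N3 a (3 * a) (4 * d) M ≡ E
  N₂≡ = trans (count3≡count (range M M) (quadForm (+ a) (+ (3 * a)) (+ (4 * d))) (+ M)) (count-evenLast M a>0 3a>0 d>0)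

%2≡1⇒odd : ∀ m → m % 2 ≡ 1 → Odd (+ m)
%2≡1⇒odd m m%2≡1 =
  odd-pos (m / 2) (trans (m≡m%n+[m/n]*n m 2) (trans (cong (λ r → r + m / 2 * 2) m%2≡1) (lemma (m / 2)))) (+ 0 , refl)
  where lemma : ∀ q → 1 + q * 2 ≡ 2 * q + 1
        lemma = ℕ-Solver.solve-∀

%4≡2⇒m≡2*odd : ∀ m → m % 4 ≡ 2 → m ≡ 2 * (m / 2) × Odd (+ (m / 2))
%4≡2⇒m≡2*odd m m%4≡2 =
  trans m≡ (trans (ℕ.*-comm (2 * (m / 4) + 1) 2) (cong (2 *_) (sym half≡))) , odd-pos (m / 4) half≡ (+ 0 , refl)
  where
  lemma : ∀ q → 2 + q * 4 ≡ (2 * q + 1) * 2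
  lemma = ℕ-Solver.solve-∀
  m≡ : m ≡ (2 * (m / 4) + 1) * 2
  m≡ = trans (m≡m%n+[m/n]*n m 4) (trans (cong (λ r → r + m / 4 * 4) m%4≡2) (lemma (m / 4)))
  half≡ : m / 2 ≡ 2 * (m / 4) + 1
  half≡ = trans (cong (_/ 2) m≡) (m*n/n≡m _ 2)

%4≡0⇒m≡4*[m/4] : ∀ m → m % 4 ≡ 0 → m ≡ 4 * (m / 4)
%4≡0⇒m≡4*[m/4] m m%4≡0 = trans (m≡m%n+[m/n]*n m 4) (trans (cong (λ r → r + m / 4 * 4) m%4≡0) (ℕ.*-comm (m / 4) 4))

theorem3p4 : (a b n : ℕ) → a > 0 → b > 0 → n > 0 → a % 2 ≡ 1 →
    ((b % 2 ≡ 1 → t3 a (3 * a) b n ≡ 2 * N3 (4 * a) (12 * a) b (8 * n + 4 * a + b))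
    × (b % 4 ≡ 2 → t3 a (3 * a) b n ≡ 2 * N3 (2 * a) (6 * a) (b / 2) (4 * n + 2 * a + b / 2))
    × (b % 4 ≡ 0 → + t3 a (3 * a) b n
          ≡ + (2 * N3 a (3 * a) (b / 4) (2 * n + a + b / 4))
            - + (2 * N3 a (3 * a) b (2 * n + a + b / 4))))
theorem3p4 a b n _ b>0 _ a%2≡1 = odd-case , 2mod4-case , 0mod4-case
  where
  odd-a : Odd (+ a)
  odd-a = %2≡1⇒odd a a%2≡1
  c d : ℕ
  c = b / 2
  d = b / 4
  odd-case : b % 2 ≡ 1 → t3 a (3 * a) b n ≡ 2 * N3 (4 * a) (12 * a) b (8 * n + 4 * a + b)
  odd-case b%2≡1 = t3-odd a b n odd-a (%2≡1⇒odd b b%2≡1)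
  2mod4-case : b % 4 ≡ 2 → t3 a (3 * a) b n ≡ 2 * N3 (2 * a) (6 * a) c (4 * n + 2 * a + c)
  2mod4-case b%4≡2 with %4≡2⇒m≡2*odd b b%4≡2
  ... | b≡2c , odd-c = subst (λ b′ → t3 a (3 * a) b′ n ≡ 2 * N3 (2 * a) (6 * a) c (4 * n + 2 * a + c))
                             (sym b≡2c) (t3-2mod4 a c n odd-a odd-c)
  0mod4-case : b % 4 ≡ 0 →
    + t3 a (3 * a) b n ≡ + (2 * N3 a (3 * a) d (2 * n + a + d)) - + (2 * N3 a (3 * a) b (2 * n + a + d))
  0mod4-case b%4≡0 =
    subst (λ b′ → + t3 a (3 * a) b′ n ≡ + (2 * N3 a (3 * a) d M) - + (2 * N3 a (3 * a) b′ M))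
          (sym b≡4d) (t3-0mod4 a d n odd-a (ℕ.*-cancelˡ-< 4 0 d (subst (0 ℕ.<_) b≡4d b>0)))
    where
    M : ℕ
    M = 2 * n + a + d
    b≡4d : b ≡ 4 * d
    b≡4d = %4≡0⇒m≡4*[m/4] b b%4≡0
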